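{- Let $k\ge 1$ and $0\le r<k$ be integers and let $n\ge 1$. Then $$\sum_{j=0}^{n}(-1)^j\begin{bmatrix} r+1\\ j\end{bmatrix}q^{nkj+\binom{j}{2}-k\binom{j+1}{2}}F^{(k)}_{k(n-j)+r}(x;q)=x^{r+1}F^{(k)}_{kn-1}(x;q),$$ and for every integer $i$ with $0<i<k+n$, $$\sum_{j=0}^{n-1}(-1)^{n-1-j}\begin{bmatrix} i-k+r\\ n-1-j\end{bmatrix}x^kq^{\binom{n-j-1}{2}-k\binom{n-j}{2}+(n-j-1)(kn-i+1)}F^{(k)}_{kj+r}(x;q)=x^{r+i}F^{(k)}_{kn-i}(x;q).$$
   Context: For an integer $a$ (possibly negative) and integer $m$, the $q$-binomial coefficient is $\begin{bmatrix} a\\ m\end{bmatrix}=\prod_{t=0}^{m-1}\frac{1-q^{a-t}}{1-q^{t+1}}$ for $m\ge 0$ and $0$ for $m<0$ (for $a\ge 0$ this is the usual Gaussian binomial, vanishing for $m>a$). For a positive integer $k$, the $q$-Fibonacci polynomials $F^{(k)}_N(x;q)$ are defined by $F^{(k)}_N(x;q)=x^N$ for $0\le N<k$ and $F^{(k)}_{N+k}(x;q)=xF^{(k)}_{N+k-1}(x;q)+q^NF^{(k)}_N(x;q)$ for $N\ge 0$; explicitly $F^{(k)}_N(x;q)=\sum_{j=0}^{\lfloor N/k\rfloor}q^{k\binom{j}{2}}\begin{bmatrix} N-(k-1)j\\ j\end{bmatrix}x^{N-kj}$. -}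

module Defs where

open import Data.Nat as ℕ using (ℕ; zero; suc; _∸_; _<?_)
open import Data.Integer as ℤ using (ℤ; +_; -[1+_])
open import Data.Rational using (ℚ; 0ℚ; 1ℚ; _+_; _*_; _-_; -_; 1/_; ≢-nonZero)
open import Data.Rational.Properties using (_≟_)
open import Relation.Nullary using (yes; no)

infixr 8 _^ℕ_
_^ℕ_ : ℚ → ℕ → ℚ
p ^ℕ zero  = 1ℚ
p ^ℕ suc n = p * (p ^ℕ n)

-- inverse in ℚ, with the (never used) convention 1/0 = 0
inv : ℚ → ℚ
inv p with p ≟ 0ℚ
... | yes _  = 0ℚ
... | no p≢0 = 1/_ p {{≢-nonZero p≢0}}

_÷'_ : ℚ → ℚ → ℚ
p ÷' d = p * inv d

_^ℤ_ : ℚ → ℤ → ℚ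
p ^ℤ (+ n)    = p ^ℕ n
p ^ℤ -[1+ n ] = inv (p ^ℕ suc n)

sgn : ℕ → ℚ
sgn j = (- 1ℚ) ^ℕ j

sumTo : ℕ → (ℕ → ℚ) → ℚ
sumTo zero    f = f 0
sumTo (suc n) f = sumTo n f + f (suc n)

prodBelow : ℕ → (ℕ → ℚ) → ℚ
prodBelow zero    f = 1ℚ
prodBelow (suc m) f = prodBelow m f * f m

qbinom : ℚ → ℤ → ℤ → ℚ
qbinom q a (+ m)     = prodBelow m (λ t → (1ℚ - q ^ℤ (a ℤ.- + t)) ÷' (1ℚ - q ^ℕ suc t))
qbinom q a -[1+ _ ]  = 0ℚ

-- q-Fibonacci polynomials F^{(k)}_N(x;q) by the defining recurrence
--   F_N = x^N for N < k,   F_{N} = x F_{N-1} + q^{N-k} F_{N-k} for N ≥ k,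
-- implemented with a fuel argument (fuel N+1 suffices since k ≥ 1).
qFibAux : ℕ → ℚ → ℚ → ℕ → ℕ → ℚ
qFibAux k x q zero       N = 0ℚ
qFibAux k x q (suc fuel) N with N <? k
... | yes _ = x ^ℕ N
... | no  _ = x * qFibAux k x q fuel (N ∸ 1) + (q ^ℕ (N ∸ k)) * qFibAux k x q fuel (N ∸ k)

qFib : (k : ℕ) → ℚ → ℚ → ℕ → ℚ
qFib k x q N = qFibAux k x q (suc N) N

-- Both identities rest on the q-Pascal rules for the q-binomials and on the recurrence
-- F_{N+k} = x F_{N+k-1} + q^N F_N.
-- First identity, by induction on r: splitting [r+2, j+1] by q-Pascal and F_{k(n-j)+r+1} by the
-- recurrence, the sum for r + 1 telescopes into x times the sum for r.  For r = 0 only the terms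
-- j = 0, 1 survive, and they combine to x F_{kn-1} by the recurrence.
-- Second identity, by induction on n: both sides S_n(i) satisfy
-- S_n(i) = S_n(i+1) + q^{k(n-1)-i} S_{n-1}(i), so their difference does not depend on i in the range
-- 0 < i < k + n; at i = k - r the upper index i - k + r is 0, every term but the last vanishes, and
-- the identity is checked directly.

module Submission where

open import Defs
open import Data.Nat using (ℕ; zero; suc; _+_; _*_; _∸_; _≤_; _<_; z≤n; s≤s; _<?_)
import Data.Nat.Properties as ℕP
open import Data.Nat.Combinatorics using (_C_; nCk+nC[k+1]≡[n+1]C[k+1]; nC1≡n)
import Data.Nat.Tactic.RingSolver as ℕRing
open import Data.Integer using (ℤ; +_; -[1+_]) renaming (_+_ to _+ℤ_; _-_ to _-ℤ_; _*_ to _*ℤ_)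
import Data.Integer.Properties as ℤP
import Data.Integer.Tactic.RingSolver as ℤRing
open import Data.Rational using (ℚ; 0ℚ; 1ℚ; -_; ∣_∣)
  renaming (_*_ to _*ℚ_; _+_ to _+ℚ_; _-_ to _-ℚ_; _<_ to _<ℚ_; _≤_ to _≤ℚ_)
import Data.Rational as ℚ
import Data.Rational.Properties as ℚP
open import Data.Rational.Solver using (module +-*-Solver)
open import Algebra.Properties.Group ℚP.+-0-group using (x∙y⁻¹≈ε⇒x≈y)
open import Data.Product using (_×_; _,_)
open import Data.Sum using (inj₁; inj₂)
open import Relation.Binary.Definitions using (tri<; tri≈; tri>)
open import Relation.Nullary using (yes; no; contradiction)
open import Relation.Binary.PropositionalEquality using (_≡_; _≢_; refl; sym; trans; cong; cong₂; subst; module ≡-Reasoning)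
open ≡-Reasoning

C2-suc : ∀ j → suc j C 2 ≡ j + j C 2
C2-suc j = trans (sym (nCk+nC[k+1]≡[n+1]C[k+1] j 1)) (cong (_+ j C 2) (nC1≡n j))

m∸1∸n≡m∸n∸1 : ∀ m n → m ∸ 1 ∸ n ≡ m ∸ n ∸ 1
m∸1∸n≡m∸n∸1 m n = trans (ℕP.∸-+-assoc m 1 n) (trans (cong (m ∸_) (ℕP.+-comm 1 n)) (sym (ℕP.∸-+-assoc m n 1)))

i<k+m⇒i≤k*m : ∀ {k m i} → 1 ≤ k → 1 ≤ m → i < k + m → i ≤ k * m
i<k+m⇒i≤k*m {suc k′} {suc m′} {i} _ _ (s≤s i≤k′+[1+m′]) =
  ℕP.≤-trans i≤k′+[1+m′] (ℕP.≤-trans (ℕP.≤-reflexive (ℕP.+-comm k′ (suc m′))) (ℕP.+-monoʳ-≤ (suc m′) (ℕP.m≤m*n k′ (suc m′))))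

≡-on-interval : ∀ {A : Set} (f : ℕ → A) {lo hi} → (∀ i → lo ≤ i → suc i ≤ hi → f (suc i) ≡ f i) →
                ∀ {i} → lo ≤ i → i ≤ hi → f i ≡ f lo
≡-on-interval f f-step {i = zero}  z≤n     _ = refl
≡-on-interval f f-step {i = suc i} lo≤1+i 1+i≤hi with ℕP.m≤n⇒m<n∨m≡n lo≤1+i
... | inj₁ (s≤s lo≤i) = trans (f-step i lo≤i 1+i≤hi) (≡-on-interval f f-step lo≤i (ℕP.<⇒≤ 1+i≤hi))
... | inj₂ refl       = refl

+a-+b≡+c : ∀ {a b c} → a ≡ b + c → + a -ℤ + b ≡ + c
+a-+b≡+c {b = b} {c} refl = trans (ℤP.m-n≡m⊖n (b + c) b) (trans (ℤP.⊖-≥ (ℕP.m≤m+n b c)) (cong +_ (ℕP.m+n∸m≡n b c)))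

[a+1]-[1+b]≡a-b : ∀ a b → a +ℤ + 1 -ℤ (+ 1 +ℤ b) ≡ a -ℤ b
[a+1]-[1+b]≡a-b = ℤRing.solve-∀

[a-b]+[1+b]≡a+1 : ∀ a b → a -ℤ b +ℤ (+ 1 +ℤ b) ≡ a +ℤ + 1
[a-b]+[1+b]≡a+1 = ℤRing.solve-∀

[a-b]+[c-d]≡[e-f]+g : ∀ a b c d e f g → a + c + f ≡ b + d + e + g →
                      (+ a -ℤ + b) +ℤ (+ c -ℤ + d) ≡ (+ e -ℤ + f) +ℤ + g
[a-b]+[c-d]≡[e-f]+g a b c d e f g a+c+f≡b+d+e+g = begin
  (+ a -ℤ + b) +ℤ (+ c -ℤ + d)      ≡⟨ cancel-f (+ a) (+ b) (+ c) (+ d) (+ f) ⟩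
  + (a + c + f) -ℤ + (b + d + f)    ≡⟨ cong (λ t → + t -ℤ + (b + d + f)) a+c+f≡b+d+e+g ⟩
  + (b + d + e + g) -ℤ + (b + d + f) ≡⟨ cancel-bd (+ b) (+ d) (+ e) (+ f) (+ g) ⟩
  (+ e -ℤ + f) +ℤ + g               ∎
  where
  cancel-f : ∀ a b c d f → (a -ℤ b) +ℤ (c -ℤ d) ≡ (a +ℤ c +ℤ f) -ℤ (b +ℤ d +ℤ f)
  cancel-f = ℤRing.solve-∀
  cancel-bd : ∀ b d e f g → (b +ℤ d +ℤ e +ℤ g) -ℤ (b +ℤ d +ℤ f) ≡ (e -ℤ f) +ℤ g
  cancel-bd = ℤRing.solve-∀

inv-inverseʳ : ∀ {p} → p ≢ 0ℚ → p *ℚ inv p ≡ 1ℚ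
inv-inverseʳ {p} p≢0 with p ℚP.≟ 0ℚ
... | yes p≡0 = contradiction p≡0 p≢0
... | no p≢0′ = ℚP.*-inverseʳ p {{ℚ.≢-nonZero p≢0′}}

inv-unique : ∀ {p r} → p *ℚ r ≡ 1ℚ → inv p ≡ r
inv-unique {p} {r} pr≡1 = begin
  inv p                ≡⟨ sym (ℚP.*-identityʳ (inv p)) ⟩
  inv p *ℚ 1ℚ          ≡⟨ cong (inv p *ℚ_) (sym pr≡1) ⟩
  inv p *ℚ (p *ℚ r)    ≡⟨ sym (ℚP.*-assoc (inv p) p r) ⟩
  inv p *ℚ p *ℚ r      ≡⟨ cong (_*ℚ r) (trans (ℚP.*-comm (inv p) p) (inv-inverseʳ p≢0)) ⟩
  1ℚ *ℚ r              ≡⟨ ℚP.*-identityˡ r ⟩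
  r                    ∎
  where
  p≢0 : p ≢ 0ℚ
  p≢0 p≡0 = ℚP.1≢0 (trans (sym pr≡1) (trans (cong (_*ℚ r) p≡0) (ℚP.*-zeroˡ r)))

*-≢0 : ∀ {p r} → p ≢ 0ℚ → r ≢ 0ℚ → p *ℚ r ≢ 0ℚ
*-≢0 {p} {r} p≢0 r≢0 pr≡0 = r≢0 (begin
  r                    ≡⟨ sym (ℚP.*-identityˡ r) ⟩
  1ℚ *ℚ r              ≡⟨ cong (_*ℚ r) (sym (trans (ℚP.*-comm (inv p) p) (inv-inverseʳ p≢0))) ⟩
  inv p *ℚ p *ℚ r      ≡⟨ ℚP.*-assoc (inv p) p r ⟩
  inv p *ℚ (p *ℚ r)    ≡⟨ cong (inv p *ℚ_) pr≡0 ⟩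
  inv p *ℚ 0ℚ          ≡⟨ ℚP.*-zeroʳ (inv p) ⟩
  0ℚ                   ∎)

a′-b′≡a-b : ∀ a′ b′ c {a b} → a′ +ℚ c ≡ a → b′ +ℚ c ≡ b → a′ -ℚ b′ ≡ a -ℚ b
a′-b′≡a-b a′ b′ c refl refl =
  solve 3 (λ a′ b′ c → a′ :- b′ := (a′ :+ c) :- (b′ :+ c)) refl a′ b′ c
  where open +-*-Solver

^ℕ-≢0 : ∀ {p} n → p ≢ 0ℚ → p ^ℕ n ≢ 0ℚ
^ℕ-≢0 zero    p≢0 = ℚP.1≢0
^ℕ-≢0 (suc n) p≢0 = *-≢0 p≢0 (^ℕ-≢0 n p≢0)

^ℕ-homo-+ : ∀ p m n → p ^ℕ (m + n) ≡ p ^ℕ m *ℚ p ^ℕ n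
^ℕ-homo-+ p zero    n = sym (ℚP.*-identityˡ (p ^ℕ n))
^ℕ-homo-+ p (suc m) n = trans (cong (p *ℚ_) (^ℕ-homo-+ p m n)) (sym (ℚP.*-assoc p (p ^ℕ m) (p ^ℕ n)))

∣^ℕ∣ : ∀ p n → ∣ p ^ℕ n ∣ ≡ ∣ p ∣ ^ℕ n
∣^ℕ∣ p zero    = refl
∣^ℕ∣ p (suc n) = trans (ℚP.∣p*q∣≡∣p∣*∣q∣ p (p ^ℕ n)) (cong (∣ p ∣ *ℚ_) (∣^ℕ∣ p n))

module _ (p : ℚ) .{{_ : ℚ.NonNegative p}} where

  ^ℕ-≤1 : p ≤ℚ 1ℚ → ∀ n → p ^ℕ n ≤ℚ 1ℚ
  ^ℕ-≤1 p≤1 zero    = ℚP.≤-refl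
  ^ℕ-≤1 p≤1 (suc n) = ℚP.≤-trans (ℚP.*-monoˡ-≤-nonNeg p (^ℕ-≤1 p≤1 n))
                                 (ℚP.≤-trans (ℚP.≤-reflexive (ℚP.*-identityʳ p)) p≤1)

  ^ℕ-suc-<1 : p <ℚ 1ℚ → ∀ n → p ^ℕ suc n <ℚ 1ℚ
  ^ℕ-suc-<1 p<1 n = ℚP.≤-<-trans (ℚP.*-monoˡ-≤-nonNeg p (^ℕ-≤1 (ℚP.<⇒≤ p<1) n))
                                 (ℚP.≤-<-trans (ℚP.≤-reflexive (ℚP.*-identityʳ p)) p<1)

  ^ℕ-≥1 : 1ℚ ≤ℚ p → ∀ n → 1ℚ ≤ℚ p ^ℕ n
  ^ℕ-≥1 1≤p zero    = ℚP.≤-refl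
  ^ℕ-≥1 1≤p (suc n) = ℚP.≤-trans 1≤p (ℚP.≤-trans (ℚP.≤-reflexive (sym (ℚP.*-identityʳ p)))
                                                 (ℚP.*-monoˡ-≤-nonNeg p (^ℕ-≥1 1≤p n)))

  ^ℕ-suc->1 : 1ℚ <ℚ p → ∀ n → 1ℚ <ℚ p ^ℕ suc n
  ^ℕ-suc->1 1<p n = ℚP.<-≤-trans 1<p (ℚP.≤-trans (ℚP.≤-reflexive (sym (ℚP.*-identityʳ p)))
                                                 (ℚP.*-monoˡ-≤-nonNeg p (^ℕ-≥1 (ℚP.<⇒≤ 1<p) n)))

^ℕ-suc≢1 : ∀ {q} → q ≢ 1ℚ → q ≢ - 1ℚ → ∀ n → q ^ℕ suc n ≢ 1ℚ
^ℕ-suc≢1 {q} q≢1 q≢-1 n qⁿ⁺¹≡1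
  with ℚP.<-cmp ∣ q ∣ 1ℚ | trans (sym (∣^ℕ∣ q (suc n))) (cong ∣_∣ qⁿ⁺¹≡1)
... | tri< ∣q∣<1 _ _ | ∣q∣ⁿ⁺¹≡1 = ℚP.<-irrefl ∣q∣ⁿ⁺¹≡1 (^ℕ-suc-<1 ∣ q ∣ {{ℚP.∣-∣-nonNeg q}} ∣q∣<1 n)
... | tri> _ _ ∣q∣>1 | ∣q∣ⁿ⁺¹≡1 = ℚP.<-irrefl (sym ∣q∣ⁿ⁺¹≡1) (^ℕ-suc->1 ∣ q ∣ {{ℚP.∣-∣-nonNeg q}} ∣q∣>1 n)
... | tri≈ _ ∣q∣≡1 _ | _ with ℚP.∣p∣≡p∨∣p∣≡-p q
...   | inj₁ ∣q∣≡q  = q≢1 (trans (sym ∣q∣≡q) ∣q∣≡1)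
...   | inj₂ ∣q∣≡-q = q≢-1 (ℚP.neg-injective (trans (sym ∣q∣≡-q) ∣q∣≡1))

^ℤ[m-n]≡^ℕ[m∸n] : ∀ q {m n} → n ≤ m → q ^ℤ (+ m -ℤ + n) ≡ q ^ℕ (m ∸ n)
^ℤ[m-n]≡^ℕ[m∸n] q {m} {n} n≤m = cong (q ^ℤ_) (trans (ℤP.m-n≡m⊖n m n) (ℤP.⊖-≥ n≤m))

module IntegerPowers {q : ℚ} (q≢0 : q ≢ 0ℚ) where
  open +-*-Solver

  ^ℤ-suc : ∀ z → q ^ℤ (z +ℤ + 1) ≡ q ^ℤ z *ℚ q
  ^ℤ-suc (+ n)            = trans (^ℕ-homo-+ q n 1) (cong (q ^ℕ n *ℚ_) (ℚP.*-identityʳ q))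
  ^ℤ-suc -[1+ zero ]      = sym (begin
    inv (q *ℚ 1ℚ) *ℚ q     ≡⟨ cong (λ t → inv t *ℚ q) (ℚP.*-identityʳ q) ⟩
    inv q *ℚ q             ≡⟨ ℚP.*-comm (inv q) q ⟩
    q *ℚ inv q             ≡⟨ inv-inverseʳ q≢0 ⟩
    1ℚ                     ∎)
  ^ℤ-suc -[1+ suc n ]     = inv-unique {qⁿ⁺¹} (begin
    qⁿ⁺¹ *ℚ (inv (q *ℚ qⁿ⁺¹) *ℚ q)  ≡⟨ solve 3 (λ a b c → a :* (b :* c) := (c :* a) :* b) refl qⁿ⁺¹ (inv (q *ℚ qⁿ⁺¹)) q ⟩
    q *ℚ qⁿ⁺¹ *ℚ inv (q *ℚ qⁿ⁺¹)    ≡⟨ inv-inverseʳ (^ℕ-≢0 (suc (suc n)) q≢0) ⟩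
    1ℚ                              ∎)
    where qⁿ⁺¹ = q ^ℕ suc n

  ^ℤ-homo-+ℕ : ∀ z n → q ^ℤ (z +ℤ + n) ≡ q ^ℤ z *ℚ q ^ℕ n
  ^ℤ-homo-+ℕ z zero    = trans (cong (q ^ℤ_) (ℤP.+-identityʳ z)) (sym (ℚP.*-identityʳ (q ^ℤ z)))
  ^ℤ-homo-+ℕ z (suc n) = begin
    q ^ℤ (z +ℤ + suc n)          ≡⟨ cong (λ t → q ^ℤ (z +ℤ + t)) (ℕP.+-comm 1 n) ⟩
    q ^ℤ (z +ℤ (+ n +ℤ + 1))     ≡⟨ cong (q ^ℤ_) (sym (ℤP.+-assoc z (+ n) (+ 1))) ⟩
    q ^ℤ (z +ℤ + n +ℤ + 1)       ≡⟨ ^ℤ-suc (z +ℤ + n) ⟩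
    q ^ℤ (z +ℤ + n) *ℚ q         ≡⟨ cong (_*ℚ q) (^ℤ-homo-+ℕ z n) ⟩
    q ^ℤ z *ℚ q ^ℕ n *ℚ q        ≡⟨ solve 3 (λ a b c → a :* b :* c := a :* (c :* b)) refl (q ^ℤ z) (q ^ℕ n) q ⟩
    q ^ℤ z *ℚ (q *ℚ q ^ℕ n)      ∎

  ^ℤ-homo-+ : ∀ z w → q ^ℤ (z +ℤ w) ≡ q ^ℤ z *ℚ q ^ℤ w
  ^ℤ-homo-+ z (+ n)      = ^ℤ-homo-+ℕ z n
  ^ℤ-homo-+ z -[1+ n ]   = begin
    q ^ℤ (z +ℤ w)                          ≡⟨ sym (ℚP.*-identityʳ _) ⟩
    q ^ℤ (z +ℤ w) *ℚ 1ℚ                    ≡⟨ cong (q ^ℤ (z +ℤ w) *ℚ_) (sym (inv-inverseʳ (^ℕ-≢0 (suc n) q≢0))) ⟩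
    q ^ℤ (z +ℤ w) *ℚ (qⁿ⁺¹ *ℚ q ^ℤ w)      ≡⟨ sym (ℚP.*-assoc (q ^ℤ (z +ℤ w)) qⁿ⁺¹ (q ^ℤ w)) ⟩
    q ^ℤ (z +ℤ w) *ℚ qⁿ⁺¹ *ℚ q ^ℤ w        ≡⟨ cong (_*ℚ q ^ℤ w) (sym (^ℤ-homo-+ℕ (z +ℤ w) (suc n))) ⟩
    q ^ℤ (z +ℤ w +ℤ + suc n) *ℚ q ^ℤ w     ≡⟨ cong (λ t → q ^ℤ t *ℚ q ^ℤ w) z+w+n+1≡z ⟩
    q ^ℤ z *ℚ q ^ℤ w                       ∎
    where
    w = -[1+ n ]
    qⁿ⁺¹ = q ^ℕ suc n
    z+w+n+1≡z : z +ℤ w +ℤ + suc n ≡ z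
    z+w+n+1≡z = trans (ℤP.+-assoc z w (+ suc n)) (trans (cong (z +ℤ_) (ℤP.n⊖n≡0 (suc n))) (ℤP.+-identityʳ z))

sumTo-cong : ∀ m {f g} → (∀ j → j ≤ m → f j ≡ g j) → sumTo m f ≡ sumTo m g
sumTo-cong zero    f≗g = f≗g 0 z≤n
sumTo-cong (suc m) f≗g = cong₂ _+ℚ_ (sumTo-cong m (λ j j≤m → f≗g j (ℕP.m≤n⇒m≤1+n j≤m))) (f≗g (suc m) ℕP.≤-refl)

sumTo-+ : ∀ m f g → sumTo m (λ j → f j +ℚ g j) ≡ sumTo m f +ℚ sumTo m g
sumTo-+ zero    f g = refl
sumTo-+ (suc m) f g = trans (cong (_+ℚ (f (suc m) +ℚ g (suc m))) (sumTo-+ m f g))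
  (solve 4 (λ a b c d → a :+ b :+ (c :+ d) := a :+ c :+ (b :+ d)) refl (sumTo m f) (sumTo m g) (f (suc m)) (g (suc m)))
  where open +-*-Solver

sumTo-*ˡ : ∀ m c f → sumTo m (λ j → c *ℚ f j) ≡ c *ℚ sumTo m f
sumTo-*ˡ zero    c f = refl
sumTo-*ˡ (suc m) c f = trans (cong (_+ℚ c *ℚ f (suc m)) (sumTo-*ˡ m c f)) (sym (ℚP.*-distribˡ-+ c (sumTo m f) (f (suc m))))

sumTo-suc : ∀ m f → sumTo (suc m) f ≡ f 0 +ℚ sumTo m (λ j → f (suc j))
sumTo-suc zero    f = refl
sumTo-suc (suc m) f = trans (cong (_+ℚ f (suc (suc m))) (sumTo-suc m f)) (ℚP.+-assoc (f 0) (sumTo m (λ j → f (suc j))) (f (suc (suc m))))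

sumTo-shift : ∀ m (a b : ℕ → ℚ) → a 0 +ℚ sumTo m (λ j → a (suc j) +ℚ b j) ≡ sumTo m (λ j → a j +ℚ b j) +ℚ a (suc m)
sumTo-shift zero    a b = solve 3 (λ a₀ a₁ b₀ → a₀ :+ (a₁ :+ b₀) := a₀ :+ b₀ :+ a₁) refl (a 0) (a 1) (b 0)
  where open +-*-Solver
sumTo-shift (suc m) a b = begin
  a 0 +ℚ (sumTo m (λ j → a (suc j) +ℚ b j) +ℚ (a (2 + m) +ℚ b (suc m)))
    ≡⟨ sym (ℚP.+-assoc (a 0) (sumTo m (λ j → a (suc j) +ℚ b j)) (a (2 + m) +ℚ b (suc m))) ⟩
  a 0 +ℚ sumTo m (λ j → a (suc j) +ℚ b j) +ℚ (a (2 + m) +ℚ b (suc m))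
    ≡⟨ cong (_+ℚ (a (2 + m) +ℚ b (suc m))) (sumTo-shift m a b) ⟩
  sumTo m (λ j → a j +ℚ b j) +ℚ a (suc m) +ℚ (a (2 + m) +ℚ b (suc m))
    ≡⟨ solve 4 (λ s x y z → s :+ x :+ (y :+ z)
                          := s :+ (x :+ z) :+ y)
             refl (sumTo m (λ j → a j +ℚ b j)) (a (suc m)) (a (2 + m)) (b (suc m)) ⟩
  sumTo m (λ j → a j +ℚ b j) +ℚ (a (suc m) +ℚ b (suc m)) +ℚ a (2 + m) ∎
  where open +-*-Solver

sumTo-first : ∀ m f → (∀ j → j < m → f (suc j) ≡ 0ℚ) → sumTo m f ≡ f 0
sumTo-first zero    f _    = refl
sumTo-first (suc m) f tail≡0 = begin
  sumTo m f +ℚ f (suc m)  ≡⟨ cong₂ _+ℚ_ (sumTo-first m f (λ j j<m → tail≡0 j (ℕP.m<n⇒m<1+n j<m))) (tail≡0 m ℕP.≤-refl) ⟩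
  f 0 +ℚ 0ℚ               ≡⟨ ℚP.+-identityʳ (f 0) ⟩
  f 0                     ∎

sumTo-last : ∀ m f → (∀ j → j < m → f j ≡ 0ℚ) → sumTo m f ≡ f m
sumTo-last zero    f _    = refl
sumTo-last (suc m) f init≡0 = begin
  sumTo m f +ℚ f (suc m)  ≡⟨ cong (_+ℚ f (suc m)) (trans (sumTo-cong m (λ j j≤m → init≡0 j (s≤s j≤m))) (sumTo-zero m)) ⟩
  0ℚ +ℚ f (suc m)         ≡⟨ ℚP.+-identityˡ (f (suc m)) ⟩
  f (suc m)               ∎
  where
  sumTo-zero : ∀ m → sumTo m (λ _ → 0ℚ) ≡ 0ℚ
  sumTo-zero zero    = refl
  sumTo-zero (suc m) = cong (_+ℚ 0ℚ) (sumTo-zero m)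

qbinom-absorb : ∀ q a m →
  qbinom q (a +ℤ + 1) (+ m) *ℚ (1ℚ -ℚ q ^ℤ (a +ℤ + 1 -ℤ + m)) ≡ qbinom q a (+ m) *ℚ (1ℚ -ℚ q ^ℤ (a +ℤ + 1))
qbinom-absorb q a zero    = cong (λ t → 1ℚ *ℚ (1ℚ -ℚ q ^ℤ t)) (ℤP.+-identityʳ (a +ℤ + 1))
qbinom-absorb q a (suc m) = begin
  B a′ m *ℚ ((1ℚ -ℚ q ^ℤ (a′ -ℤ + m)) *ℚ d⁻¹) *ℚ (1ℚ -ℚ q ^ℤ (a′ -ℤ + suc m))
    ≡⟨ cong (λ t → B a′ m *ℚ ((1ℚ -ℚ q ^ℤ (a′ -ℤ + m)) *ℚ d⁻¹) *ℚ (1ℚ -ℚ q ^ℤ t))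
            (trans (cong (a′ -ℤ_) (ℤP.pos-+ 1 m)) ([a+1]-[1+b]≡a-b a (+ m))) ⟩
  B a′ m *ℚ ((1ℚ -ℚ q ^ℤ (a′ -ℤ + m)) *ℚ d⁻¹) *ℚ (1ℚ -ℚ q ^ℤ (a -ℤ + m))
    ≡⟨ solve 4 (λ b x i z → b :* ((con 1ℚ :- x) :* i) :* (con 1ℚ :- z) := (b :* (con 1ℚ :- x)) :* i :* (con 1ℚ :- z))
               refl (B a′ m) (q ^ℤ (a′ -ℤ + m)) d⁻¹ (q ^ℤ (a -ℤ + m)) ⟩
  B a′ m *ℚ (1ℚ -ℚ q ^ℤ (a′ -ℤ + m)) *ℚ d⁻¹ *ℚ (1ℚ -ℚ q ^ℤ (a -ℤ + m))
    ≡⟨ cong (λ t → t *ℚ d⁻¹ *ℚ (1ℚ -ℚ q ^ℤ (a -ℤ + m))) (qbinom-absorb q a m) ⟩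
  B a m *ℚ (1ℚ -ℚ q ^ℤ a′) *ℚ d⁻¹ *ℚ (1ℚ -ℚ q ^ℤ (a -ℤ + m))
    ≡⟨ solve 4 (λ b y i z → b :* (con 1ℚ :- y) :* i :* (con 1ℚ :- z) := b :* ((con 1ℚ :- z) :* i) :* (con 1ℚ :- y))
               refl (B a m) (q ^ℤ a′) d⁻¹ (q ^ℤ (a -ℤ + m)) ⟩
  B a m *ℚ ((1ℚ -ℚ q ^ℤ (a -ℤ + m)) *ℚ d⁻¹) *ℚ (1ℚ -ℚ q ^ℤ a′) ∎
  where
  open +-*-Solver
  B : ℤ → ℕ → ℚ
  B a m = qbinom q a (+ m)
  a′ = a +ℤ + 1
  d⁻¹ = inv (1ℚ -ℚ q ^ℕ suc m)

qbinom-vanish : ∀ q m t → qbinom q (+ m) (+ suc (t + m)) ≡ 0ℚ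
qbinom-vanish q m zero    = begin
  qbinom q (+ m) (+ m) *ℚ ((1ℚ -ℚ q ^ℤ (+ m -ℤ + m)) *ℚ d⁻¹)
    ≡⟨ cong (λ z → qbinom q (+ m) (+ m) *ℚ ((1ℚ -ℚ q ^ℤ z) *ℚ d⁻¹)) (ℤP.+-inverseʳ (+ m)) ⟩
  qbinom q (+ m) (+ m) *ℚ ((1ℚ -ℚ 1ℚ) *ℚ d⁻¹)
    ≡⟨ cong (qbinom q (+ m) (+ m) *ℚ_) (ℚP.*-zeroˡ d⁻¹) ⟩
  qbinom q (+ m) (+ m) *ℚ 0ℚ
    ≡⟨ ℚP.*-zeroʳ (qbinom q (+ m) (+ m)) ⟩
  0ℚ ∎
  where d⁻¹ = inv (1ℚ -ℚ q ^ℕ suc m)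
qbinom-vanish q m (suc t) = trans (cong (_*ℚ factor) (qbinom-vanish q m t)) (ℚP.*-zeroˡ factor)
  where factor = (1ℚ -ℚ q ^ℤ (+ m -ℤ + suc (t + m))) ÷' (1ℚ -ℚ q ^ℕ suc (suc (t + m)))

module QBinomial {q : ℚ} (q≢0 : q ≢ 0ℚ) (q≢1 : q ≢ 1ℚ) (q≢-1 : q ≢ - 1ℚ) where
  open IntegerPowers q≢0
  open +-*-Solver

  private
    B : ℤ → ℕ → ℚ
    B a m = qbinom q a (+ m)

  1-q^[1+m]-inverseʳ : ∀ m → (1ℚ -ℚ q ^ℕ suc m) *ℚ inv (1ℚ -ℚ q ^ℕ suc m) ≡ 1ℚ
  1-q^[1+m]-inverseʳ m = inv-inverseʳ (λ 1-qᵐ⁺¹≡0 → ^ℕ-suc≢1 q≢1 q≢-1 m (sym (x∙y⁻¹≈ε⇒x≈y 1ℚ (q ^ℕ suc m) 1-qᵐ⁺¹≡0)))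

  qbinom-1-1 : B (+ 1) 1 ≡ 1ℚ
  qbinom-1-1 = trans (ℚP.*-identityˡ _) (1-q^[1+m]-inverseʳ 0)

  qbinom-suc-upper : ∀ a m →
    B (a +ℤ + 1) (suc m) ≡ B a m *ℚ (1ℚ -ℚ q ^ℤ (a -ℤ + m) *ℚ q ^ℕ suc m) *ℚ inv (1ℚ -ℚ q ^ℕ suc m)
  qbinom-suc-upper a m = begin
    B a′ m *ℚ ((1ℚ -ℚ q ^ℤ (a′ -ℤ + m)) *ℚ d⁻¹)  ≡⟨ sym (ℚP.*-assoc (B a′ m) _ d⁻¹) ⟩
    B a′ m *ℚ (1ℚ -ℚ q ^ℤ (a′ -ℤ + m)) *ℚ d⁻¹    ≡⟨ cong (_*ℚ d⁻¹) (qbinom-absorb q a m) ⟩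
    B a m *ℚ (1ℚ -ℚ q ^ℤ a′) *ℚ d⁻¹              ≡⟨ cong (λ t → B a m *ℚ (1ℚ -ℚ t) *ℚ d⁻¹) q^[a+1]≡q^[a-m]q^[1+m] ⟩
    B a m *ℚ (1ℚ -ℚ q ^ℤ (a -ℤ + m) *ℚ q ^ℕ suc m) *ℚ d⁻¹ ∎
    where
    a′ = a +ℤ + 1
    d⁻¹ = inv (1ℚ -ℚ q ^ℕ suc m)
    q^[a+1]≡q^[a-m]q^[1+m] : q ^ℤ a′ ≡ q ^ℤ (a -ℤ + m) *ℚ q ^ℕ suc m
    q^[a+1]≡q^[a-m]q^[1+m] = trans (cong (q ^ℤ_) (sym (trans (cong (a -ℤ + m +ℤ_) (ℤP.pos-+ 1 m)) ([a-b]+[1+b]≡a+1 a (+ m)))))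
                                   (^ℤ-homo-+ℕ (a -ℤ + m) (suc m))

  qbinom-pascal₁ : ∀ a m → B (a +ℤ + 1) (suc m) ≡ q ^ℕ suc m *ℚ B a (suc m) +ℚ B a m
  qbinom-pascal₁ a m = begin
    B (a +ℤ + 1) (suc m)
      ≡⟨ qbinom-suc-upper a m ⟩
    B a m *ℚ (1ℚ -ℚ z *ℚ p) *ℚ d⁻¹
      ≡⟨ solve 4 (λ b z p i → b :* (con 1ℚ :- z :* p) :* i
                            := p :* (b :* ((con 1ℚ :- z) :* i)) :+ b :* ((con 1ℚ :- p) :* i))
               refl (B a m) z p d⁻¹ ⟩
    p *ℚ B a (suc m) +ℚ B a m *ℚ ((1ℚ -ℚ p) *ℚ d⁻¹)
      ≡⟨ cong (λ t → p *ℚ B a (suc m) +ℚ B a m *ℚ t) (1-q^[1+m]-inverseʳ m) ⟩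
    p *ℚ B a (suc m) +ℚ B a m *ℚ 1ℚ
      ≡⟨ cong (p *ℚ B a (suc m) +ℚ_) (ℚP.*-identityʳ (B a m)) ⟩
    p *ℚ B a (suc m) +ℚ B a m ∎
    where
    z = q ^ℤ (a -ℤ + m)
    p = q ^ℕ suc m
    d⁻¹ = inv (1ℚ -ℚ p)

  qbinom-pascal₂ : ∀ a m → B (a +ℤ + 1) (suc m) ≡ B a (suc m) +ℚ q ^ℤ (a -ℤ + m) *ℚ B a m
  qbinom-pascal₂ a m = begin
    B (a +ℤ + 1) (suc m)
      ≡⟨ qbinom-suc-upper a m ⟩
    B a m *ℚ (1ℚ -ℚ z *ℚ p) *ℚ d⁻¹
      ≡⟨ solve 4 (λ b z p i → b :* (con 1ℚ :- z :* p) :* i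
                            := b :* ((con 1ℚ :- z) :* i) :+ z :* b :* ((con 1ℚ :- p) :* i))
               refl (B a m) z p d⁻¹ ⟩
    B a (suc m) +ℚ z *ℚ B a m *ℚ ((1ℚ -ℚ p) *ℚ d⁻¹)
      ≡⟨ cong (λ t → B a (suc m) +ℚ z *ℚ B a m *ℚ t) (1-q^[1+m]-inverseʳ m) ⟩
    B a (suc m) +ℚ z *ℚ B a m *ℚ 1ℚ
      ≡⟨ cong (B a (suc m) +ℚ_) (ℚP.*-identityʳ (z *ℚ B a m)) ⟩
    B a (suc m) +ℚ z *ℚ B a m ∎
    where
    z = q ^ℤ (a -ℤ + m)
    p = q ^ℕ suc m
    d⁻¹ = inv (1ℚ -ℚ p)

module QFibonacci {k : ℕ} (k≥1 : 1 ≤ k) (x q : ℚ) where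

  private
    F : ℕ → ℚ
    F = qFib k x q

  qFibAux-fuel : ∀ f f′ N → N < f → N < f′ → qFibAux k x q f N ≡ qFibAux k x q f′ N
  qFibAux-fuel (suc f) (suc f′) N (s≤s N≤f) (s≤s N≤f′) with N <? k
  ... | yes _  = refl
  ... | no N≮k = cong₂ (λ a b → x *ℚ a +ℚ q ^ℕ (N ∸ k) *ℚ b)
                   (qFibAux-fuel f f′ (N ∸ 1) (ℕP.<-≤-trans N∸1<N N≤f) (ℕP.<-≤-trans N∸1<N N≤f′))
                   (qFibAux-fuel f f′ (N ∸ k) (ℕP.<-≤-trans N∸k<N N≤f) (ℕP.<-≤-trans N∸k<N N≤f′))
    where
    k≤N = ℕP.≮⇒≥ N≮k
    N∸1<N : N ∸ 1 < N
    N∸1<N = ℕP.∸-monoʳ-< {o = 0} ℕP.0<1+n (ℕP.≤-trans k≥1 k≤N)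
    N∸k<N : N ∸ k < N
    N∸k<N = ℕP.∸-monoʳ-< {o = 0} k≥1 k≤N

  qFib-below : ∀ {N} → N < k → F N ≡ x ^ℕ N
  qFib-below {N} N<k with N <? k
  ... | yes _  = refl
  ... | no N≮k = contradiction N<k N≮k

  qFib-rec : ∀ N → F (k + N) ≡ x *ℚ F (k + N ∸ 1) +ℚ q ^ℕ N *ℚ F N
  qFib-rec N with k + N <? k
  ... | yes k+N<k = contradiction k+N<k (ℕP.≤⇒≯ (ℕP.m≤m+n k N))
  ... | no _      = begin
    x *ℚ qFibAux k x q (k + N) (k + N ∸ 1) +ℚ q ^ℕ (k + N ∸ k) *ℚ qFibAux k x q (k + N) (k + N ∸ k)
      ≡⟨ cong (λ n → x *ℚ qFibAux k x q (k + N) (k + N ∸ 1) +ℚ q ^ℕ n *ℚ qFibAux k x q (k + N) n) (ℕP.m+n∸m≡n k N) ⟩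
    x *ℚ qFibAux k x q (k + N) (k + N ∸ 1) +ℚ q ^ℕ N *ℚ qFibAux k x q (k + N) N
      ≡⟨ cong₂ (λ a b → x *ℚ a +ℚ q ^ℕ N *ℚ b)
               (qFibAux-fuel (k + N) (suc (k + N ∸ 1)) (k + N ∸ 1) k+N∸1<k+N ℕP.≤-refl)
               (qFibAux-fuel (k + N) (suc N) N (ℕP.<-≤-trans (ℕP.m<n+m N k≥1) ℕP.≤-refl) ℕP.≤-refl) ⟩
    x *ℚ F (k + N ∸ 1) +ℚ q ^ℕ N *ℚ F N ∎
    where
    k+N∸1<k+N : k + N ∸ 1 < k + N
    k+N∸1<k+N = ℕP.∸-monoʳ-< {o = 0} ℕP.0<1+n (ℕP.≤-trans k≥1 (ℕP.m≤m+n k N))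

module FirstIdentity {k : ℕ} (k≥1 : 1 ≤ k) (x q : ℚ) (q≢0 : q ≢ 0ℚ) (q≢1 : q ≢ 1ℚ) (q≢-1 : q ≢ - 1ℚ) (n′ : ℕ) where
  open IntegerPowers q≢0
  open QBinomial q≢0 q≢1 q≢-1
  open QFibonacci k≥1 x q
  open +-*-Solver

  private
    n : ℕ
    n = suc n′
    F : ℕ → ℚ
    F = qFib k x q

  e : ℕ → ℤ
  e j = (+ (n * k * j) +ℤ + (j C 2)) -ℤ + (k * ((j + 1) C 2))

  summand : ℕ → ℕ → ℚ
  summand r j = sgn j *ℚ qbinom q (+ (r + 1)) (+ j) *ℚ q ^ℤ e j *ℚ F (k * (n ∸ j) + r)

  e-step : ∀ r j → j ≤ n′ → q ^ℤ (+ (r + 1) -ℤ + j) *ℚ q ^ℤ e (suc j) ≡ q ^ℤ e j *ℚ q ^ℕ (k * (n′ ∸ j) + (r + 1))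
  e-step r j j≤n′ = begin
    q ^ℤ (+ (r + 1) -ℤ + j) *ℚ q ^ℤ e (suc j)
      ≡⟨ sym (^ℤ-homo-+ (+ (r + 1) -ℤ + j) (e (suc j))) ⟩
    q ^ℤ ((+ (r + 1) -ℤ + j) +ℤ e (suc j))
      ≡⟨ cong (q ^ℤ_) ([a-b]+[c-d]≡[e-f]+g (r + 1) j (n * k * suc j + suc j C 2) (k * ((suc j + 1) C 2))
                                           (n * k * j + j C 2) (k * ((j + 1) C 2)) (k * (n′ ∸ j) + (r + 1))
                                           (exponents (n′ ∸ j) (sym (ℕP.m+[n∸m]≡n j≤n′)))) ⟩
    q ^ℤ (e j +ℤ + (k * (n′ ∸ j) + (r + 1)))
      ≡⟨ ^ℤ-homo-+ℕ (e j) (k * (n′ ∸ j) + (r + 1)) ⟩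
    q ^ℤ e j *ℚ q ^ℕ (k * (n′ ∸ j) + (r + 1)) ∎
    where
    polynomial : ∀ k r j s c → (r + 1) + ((1 + (j + s)) * k * (1 + j) + (j + c)) + k * (j + c)
                             ≡ j + k * ((1 + j) + (j + c)) + ((1 + (j + s)) * k * j + c) + (k * s + (r + 1))
    polynomial = ℕRing.solve-∀
    exponents : ∀ s → n′ ≡ j + s →
      (r + 1) + (n * k * suc j + suc j C 2) + k * ((j + 1) C 2)
      ≡ j + k * ((suc j + 1) C 2) + (n * k * j + j C 2) + (k * (n′ ∸ j) + (r + 1))
    exponents s refl rewrite ℕP.m+n∸m≡n j s | ℕP.+-comm j 1 | C2-suc (suc j) | C2-suc j = polynomial k r j s (j C 2)

  summand-0-≥2 : ∀ j → summand 0 (2 + j) ≡ 0ℚ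
  summand-0-≥2 j = begin
    sgn (2 + j) *ℚ qbinom q (+ 1) (+ (2 + j)) *ℚ q ^ℤ e (2 + j) *ℚ F (k * (n ∸ (2 + j)) + 0)
      ≡⟨ cong (λ b → sgn (2 + j) *ℚ b *ℚ q ^ℤ e (2 + j) *ℚ F (k * (n ∸ (2 + j)) + 0))
              (trans (cong (λ t → qbinom q (+ 1) (+ suc t)) (ℕP.+-comm 1 j)) (qbinom-vanish q 1 j)) ⟩
    sgn (2 + j) *ℚ 0ℚ *ℚ q ^ℤ e (2 + j) *ℚ F (k * (n ∸ (2 + j)) + 0)
      ≡⟨ solve 3 (λ s p f → s :* con 0ℚ :* p :* f := con 0ℚ) refl (sgn (2 + j)) (q ^ℤ e (2 + j)) (F (k * (n ∸ (2 + j)) + 0)) ⟩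
    0ℚ ∎

  summand-0-0 : summand 0 0 ≡ F (k + k * n′)
  summand-0-0 = begin
    1ℚ *ℚ 1ℚ *ℚ q ^ℤ e 0 *ℚ F (k * n + 0)
      ≡⟨ cong₂ (λ z N → 1ℚ *ℚ 1ℚ *ℚ q ^ℤ z *ℚ F N) e0≡0 (trans (ℕP.+-identityʳ (k * n)) (ℕP.*-suc k n′)) ⟩
    1ℚ *ℚ 1ℚ *ℚ 1ℚ *ℚ F (k + k * n′)
      ≡⟨ solve 1 (λ f → con 1ℚ :* con 1ℚ :* con 1ℚ :* f := f) refl (F (k + k * n′)) ⟩
    F (k + k * n′) ∎
    where
    e0≡0 : e 0 ≡ + 0
    e0≡0 = +a-+b≡+c (trans (ℕP.+-identityʳ (n * k * 0)) (trans (ℕP.*-zeroʳ (n * k)) (sym (trans (ℕP.+-identityʳ (k * 0)) (ℕP.*-zeroʳ k)))))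

  summand-0-1 : summand 0 1 ≡ (- 1ℚ) *ℚ (q ^ℕ (k * n′) *ℚ F (k * n′))
  summand-0-1 = begin
    sgn 1 *ℚ qbinom q (+ 1) (+ 1) *ℚ q ^ℤ e 1 *ℚ F (k * n′ + 0)
      ≡⟨ cong₂ (λ b z → sgn 1 *ℚ b *ℚ q ^ℤ z *ℚ F (k * n′ + 0)) qbinom-1-1 e1≡kn′ ⟩
    sgn 1 *ℚ 1ℚ *ℚ q ^ℕ (k * n′) *ℚ F (k * n′ + 0)
      ≡⟨ cong (λ N → sgn 1 *ℚ 1ℚ *ℚ q ^ℕ (k * n′) *ℚ F N) (ℕP.+-identityʳ (k * n′)) ⟩
    sgn 1 *ℚ 1ℚ *ℚ q ^ℕ (k * n′) *ℚ F (k * n′)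
      ≡⟨ solve 2 (λ p f → con (- 1ℚ) :* con 1ℚ :* con 1ℚ :* p :* f := con (- 1ℚ) :* (p :* f)) refl (q ^ℕ (k * n′)) (F (k * n′)) ⟩
    (- 1ℚ) *ℚ (q ^ℕ (k * n′) *ℚ F (k * n′)) ∎
    where
    e1≡kn′ : e 1 ≡ + (k * n′)
    e1≡kn′ = +a-+b≡+c (begin
      n * k * 1 + 0  ≡⟨ ℕP.+-identityʳ (n * k * 1) ⟩
      n * k * 1      ≡⟨ ℕP.*-identityʳ (n * k) ⟩
      n * k          ≡⟨ ℕP.*-comm n k ⟩
      k * n          ≡⟨ ℕP.*-suc k n′ ⟩
      k + k * n′     ≡⟨ cong (_+ k * n′) (sym (ℕP.*-identityʳ k)) ⟩
      k * 1 + k * n′ ∎)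

  identity-base : sumTo n (summand 0) ≡ x ^ℕ 1 *ℚ F (k * n ∸ 1)
  identity-base = begin
    sumTo n (summand 0)
      ≡⟨ sumTo-suc n′ (summand 0) ⟩
    summand 0 0 +ℚ sumTo n′ (λ j → summand 0 (suc j))
      ≡⟨ cong (summand 0 0 +ℚ_) (sumTo-first n′ (λ j → summand 0 (suc j)) (λ j _ → summand-0-≥2 j)) ⟩
    summand 0 0 +ℚ summand 0 1
      ≡⟨ cong₂ _+ℚ_ summand-0-0 summand-0-1 ⟩
    F (k + k * n′) +ℚ (- 1ℚ) *ℚ (q ^ℕ (k * n′) *ℚ F (k * n′))
      ≡⟨ cong (_+ℚ (- 1ℚ) *ℚ (q ^ℕ (k * n′) *ℚ F (k * n′))) (qFib-rec (k * n′)) ⟩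
    x *ℚ F (k + k * n′ ∸ 1) +ℚ q ^ℕ (k * n′) *ℚ F (k * n′) +ℚ (- 1ℚ) *ℚ (q ^ℕ (k * n′) *ℚ F (k * n′))
      ≡⟨ solve 4 (λ x a p b → x :* a :+ p :* b :+ con (- 1ℚ) :* (p :* b)
                            := x :* con 1ℚ :* a)
               refl x (F (k + k * n′ ∸ 1)) (q ^ℕ (k * n′)) (F (k * n′)) ⟩
    x ^ℕ 1 *ℚ F (k + k * n′ ∸ 1)
      ≡⟨ cong (λ N → x ^ℕ 1 *ℚ F (N ∸ 1)) (sym (ℕP.*-suc k n′)) ⟩
    x ^ℕ 1 *ℚ F (k * n ∸ 1) ∎

  module Step (r : ℕ) (r+1<k : suc r < k) where

    -- U and V are chosen so that the sum for 1 + r telescopes against x times the sum for r.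
    U V : ℕ → ℚ
    U j = sgn j *ℚ qbinom q (+ (r + 1)) (+ j) *ℚ q ^ℤ e j *ℚ F (k * (n ∸ j) + suc r)
    V j = (- 1ℚ) *ℚ sgn j *ℚ qbinom q (+ (r + 1)) (+ j) *ℚ q ^ℤ e j *ℚ q ^ℕ (k * (n′ ∸ j) + suc r) *ℚ F (k * (n′ ∸ j) + suc r)

    summand-suc : ∀ j → j ≤ n′ → summand (suc r) (suc j) ≡ U (suc j) +ℚ V j
    summand-suc j j≤n′ = begin
      summand (suc r) (suc j)
        ≡⟨ cong (λ a → sgn (suc j) *ℚ qbinom q (+ a) (+ suc j) *ℚ E′ *ℚ F′) (ℕP.+-comm 1 (r + 1)) ⟩
      sgn (suc j) *ℚ qbinom q (+ (r + 1) +ℤ + 1) (+ suc j) *ℚ E′ *ℚ F′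
        ≡⟨ cong (λ b → sgn (suc j) *ℚ b *ℚ E′ *ℚ F′) (qbinom-pascal₂ (+ (r + 1)) j) ⟩
      sgn (suc j) *ℚ (B′ +ℚ Z *ℚ B) *ℚ E′ *ℚ F′
        ≡⟨ solve 6 (λ s b′ z b e′ f → (con (- 1ℚ) :* s) :* (b′ :+ z :* b) :* e′ :* f
                                   := (con (- 1ℚ) :* s) :* b′ :* e′ :* f :+ con (- 1ℚ) :* s :* b :* (z :* e′) :* f)
                 refl (sgn j) B′ Z B E′ F′ ⟩
      U (suc j) +ℚ (- 1ℚ) *ℚ sgn j *ℚ B *ℚ (Z *ℚ E′) *ℚ F′
        ≡⟨ cong (λ t → U (suc j) +ℚ (- 1ℚ) *ℚ sgn j *ℚ B *ℚ t *ℚ F′) (e-step r j j≤n′) ⟩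
      U (suc j) +ℚ (- 1ℚ) *ℚ sgn j *ℚ B *ℚ (q ^ℤ e j *ℚ q ^ℕ (k * (n′ ∸ j) + (r + 1))) *ℚ F′
        ≡⟨ cong (λ t → U (suc j) +ℚ (- 1ℚ) *ℚ sgn j *ℚ B *ℚ (q ^ℤ e j *ℚ q ^ℕ (k * (n′ ∸ j) + t)) *ℚ F′) (ℕP.+-comm r 1) ⟩
      U (suc j) +ℚ (- 1ℚ) *ℚ sgn j *ℚ B *ℚ (q ^ℤ e j *ℚ P) *ℚ F′
        ≡⟨ cong (U (suc j) +ℚ_) (solve 5 (λ s b e p f → con (- 1ℚ) :* s :* b :* (e :* p) :* f := con (- 1ℚ) :* s :* b :* e :* p :* f)
                                        refl (sgn j) B (q ^ℤ e j) P F′) ⟩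
      U (suc j) +ℚ V j ∎
      where
      E′ = q ^ℤ e (suc j)
      F′ = F (k * (n′ ∸ j) + suc r)
      B′ = qbinom q (+ (r + 1)) (+ suc j)
      B  = qbinom q (+ (r + 1)) (+ j)
      Z  = q ^ℤ (+ (r + 1) -ℤ + j)
      P  = q ^ℕ (k * (n′ ∸ j) + suc r)

    x*summand : ∀ j → j ≤ n′ → x *ℚ summand r j ≡ U j +ℚ V j
    x*summand j j≤n′ = begin
      x *ℚ (c *ℚ F (k * (n ∸ j) + r))
        ≡⟨ cong (λ N → x *ℚ (c *ℚ F N)) N∸1≡k+M∸1 ⟩
      x *ℚ (c *ℚ F (k + M ∸ 1))
        ≡⟨ solve 7 (λ x s b z f₁ p f₂ → x :* (s :* b :* z :* f₁)
                                      := s :* b :* z :* (x :* f₁ :+ p :* f₂) :+ con (- 1ℚ) :* s :* b :* z :* p :* f₂)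
                   refl x (sgn j) (qbinom q (+ (r + 1)) (+ j)) (q ^ℤ e j) (F (k + M ∸ 1)) (q ^ℕ M) (F M) ⟩
      c *ℚ (x *ℚ F (k + M ∸ 1) +ℚ q ^ℕ M *ℚ F M) +ℚ V j
        ≡⟨ cong (λ f → c *ℚ f +ℚ V j) (sym (qFib-rec M)) ⟩
      c *ℚ F (k + M) +ℚ V j
        ≡⟨ cong (λ N → c *ℚ F N +ℚ V j) (sym N≡k+M) ⟩
      U j +ℚ V j ∎
      where
      c = sgn j *ℚ qbinom q (+ (r + 1)) (+ j) *ℚ q ^ℤ e j
      M = k * (n′ ∸ j) + suc r
      N≡k+M : k * (n ∸ j) + suc r ≡ k + M
      N≡k+M = trans (cong (λ t → k * t + suc r) (ℕP.+-∸-assoc 1 j≤n′))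
                    (trans (cong (_+ suc r) (ℕP.*-suc k (n′ ∸ j))) (ℕP.+-assoc k (k * (n′ ∸ j)) (suc r)))
      N∸1≡k+M∸1 : k * (n ∸ j) + r ≡ k + M ∸ 1
      N∸1≡k+M∸1 = trans (sym (cong (_∸ 1) (ℕP.+-suc (k * (n ∸ j)) r))) (cong (_∸ 1) N≡k+M)

    x*summand-last : x *ℚ summand r n ≡ U n
    x*summand-last = begin
      x *ℚ (c *ℚ F (k * (n ∸ n) + r))  ≡⟨ cong (λ N → x *ℚ (c *ℚ F (N + r))) kn∸n≡0 ⟩
      x *ℚ (c *ℚ F r)                  ≡⟨ cong (λ f → x *ℚ (c *ℚ f)) (qFib-below (ℕP.<-trans (ℕP.n<1+n r) r+1<k)) ⟩
      x *ℚ (c *ℚ x ^ℕ r)               ≡⟨ solve 3 (λ x c p → x :* (c :* p) := c :* (x :* p)) refl x c (x ^ℕ r) ⟩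
      c *ℚ x ^ℕ suc r                  ≡⟨ cong (c *ℚ_) (sym (qFib-below r+1<k)) ⟩
      c *ℚ F (suc r)                   ≡⟨ cong (λ N → c *ℚ F (N + suc r)) (sym kn∸n≡0) ⟩
      U n                              ∎
      where
      c = sgn n *ℚ qbinom q (+ (r + 1)) (+ n) *ℚ q ^ℤ e n
      kn∸n≡0 : k * (n ∸ n) ≡ 0
      kn∸n≡0 = trans (cong (k *_) (ℕP.n∸n≡0 n)) (ℕP.*-zeroʳ k)

    identity-step : sumTo n (summand r) ≡ x ^ℕ (r + 1) *ℚ F (k * n ∸ 1) →
                    sumTo n (summand (suc r)) ≡ x ^ℕ (suc r + 1) *ℚ F (k * n ∸ 1)
    identity-step ih = begin
      sumTo n (summand (suc r))                                   ≡⟨ sumTo-suc n′ (summand (suc r)) ⟩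
      U 0 +ℚ sumTo n′ (λ j → summand (suc r) (suc j))             ≡⟨ cong (U 0 +ℚ_) (sumTo-cong n′ summand-suc) ⟩
      U 0 +ℚ sumTo n′ (λ j → U (suc j) +ℚ V j)                    ≡⟨ sumTo-shift n′ U V ⟩
      sumTo n′ (λ j → U j +ℚ V j) +ℚ U n                          ≡⟨ sym (cong₂ _+ℚ_ (sumTo-cong n′ x*summand) x*summand-last) ⟩
      sumTo n (λ j → x *ℚ summand r j)                            ≡⟨ sumTo-*ˡ n x (summand r) ⟩
      x *ℚ sumTo n (summand r)                                    ≡⟨ cong (x *ℚ_) ih ⟩
      x *ℚ (x ^ℕ (r + 1) *ℚ F (k * n ∸ 1))                        ≡⟨ sym (ℚP.*-assoc x (x ^ℕ (r + 1)) (F (k * n ∸ 1))) ⟩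
      x ^ℕ (suc r + 1) *ℚ F (k * n ∸ 1)                           ∎

  identity : ∀ r → r < k → sumTo n (summand r) ≡ x ^ℕ (r + 1) *ℚ F (k * n ∸ 1)
  identity zero    _   = identity-base
  identity (suc r) r+1<k = Step.identity-step r r+1<k (identity r (ℕP.<-trans (ℕP.n<1+n r) r+1<k))

module SecondIdentity {k r : ℕ} (k≥1 : 1 ≤ k) (r<k : r < k) (x q : ℚ) (q≢0 : q ≢ 0ℚ) (q≢1 : q ≢ 1ℚ) (q≢-1 : q ≢ - 1ℚ) where
  open IntegerPowers q≢0
  open QBinomial q≢0 q≢1 q≢-1
  open QFibonacci k≥1 x q
  open +-*-Solver

  private
    F : ℕ → ℚ
    F = qFib k x q

  a : ℕ → ℤ
  a i = (+ i -ℤ + k) +ℤ + r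

  e : ℕ → ℕ → ℕ → ℤ
  e n i s = ((+ (s C 2)) -ℤ + (k * (suc s C 2))) +ℤ (+ s *ℤ ((+ (k * n) -ℤ + i) +ℤ + 1))

  summand : ℕ → ℕ → ℕ → ℚ
  summand n i j = sgn (n ∸ 1 ∸ j) *ℚ qbinom q (a i) (+ (n ∸ 1 ∸ j))
    *ℚ (x ^ℕ k)
    *ℚ (q ^ℤ (((+ ((n ∸ j ∸ 1) C 2)) -ℤ + (k * ((n ∸ j) C 2)))
               +ℤ (+ (n ∸ j ∸ 1) *ℤ ((+ (k * n) -ℤ + i) +ℤ + 1))))
    *ℚ F (k * j + r)

  -- summand n i j, reindexed by s = n - 1 - j
  term : ℕ → ℕ → ℕ → ℕ → ℚ
  term n i s j = sgn s *ℚ qbinom q (a i) (+ s) *ℚ x ^ℕ k *ℚ q ^ℤ e n i s *ℚ F (k * j + r)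

  summand≡term : ∀ n i j s → n ∸ j ≡ suc s → summand n i j ≡ term n i s j
  summand≡term n i j s n∸j≡1+s rewrite m∸1∸n≡m∸n∸1 n j | n∸j≡1+s = refl

  a-suc : ∀ i → a (suc i) ≡ a i +ℤ + 1
  a-suc i = polynomial (+ i) (+ k) (+ r)
    where
    polynomial : ∀ I K R → ((+ 1 +ℤ I) -ℤ K) +ℤ R ≡ ((I -ℤ K) +ℤ R) +ℤ + 1
    polynomial = ℤRing.solve-∀

  e-suc-i : ∀ n i s → e n i (suc s) ≡ e n (suc i) (suc s) +ℤ + suc s
  e-suc-i n i s = polynomial (+ (suc s C 2) -ℤ + (k * (suc (suc s) C 2))) (+ suc s) (+ (k * n)) (+ i)
    where
    polynomial : ∀ A S K I → A +ℤ S *ℤ ((K -ℤ I) +ℤ + 1) ≡ (A +ℤ S *ℤ ((K -ℤ (+ 1 +ℤ I)) +ℤ + 1)) +ℤ S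
    polynomial = ℤRing.solve-∀

  e-suc : ∀ m i s → e (suc m) (suc i) (suc s) ≡ e m i s +ℤ (+ (k * m) -ℤ + i)
  e-suc m i s
    rewrite C2-suc (suc s) | C2-suc s | ℕP.*-suc k m | ℤP.pos-* k (suc s + (s + s C 2)) | ℤP.pos-* k (s + s C 2)
    = polynomial (+ k) (+ (k * m)) (+ i) (+ s) (+ (s C 2))
    where
    polynomial : ∀ K KM I S c →
      ((S +ℤ c) -ℤ K *ℤ ((+ 1 +ℤ S) +ℤ (S +ℤ c))) +ℤ (+ 1 +ℤ S) *ℤ (((K +ℤ KM) -ℤ (+ 1 +ℤ I)) +ℤ + 1)
      ≡ ((c -ℤ K *ℤ (S +ℤ c)) +ℤ S *ℤ ((KM -ℤ I) +ℤ + 1)) +ℤ (KM -ℤ I)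
    polynomial = ℤRing.solve-∀

  G : ℕ → ℕ → ℚ
  G m i = q ^ℤ (+ (k * m) -ℤ + i)

  term-rec : ∀ m i s j → term (suc m) (suc i) (suc s) j +ℚ G m i *ℚ term m i s j ≡ term (suc m) i (suc s) j
  term-rec m i s j = begin
    sgn (suc s) *ℚ qbinom q (a (suc i)) (+ suc s) *ℚ X *ℚ q ^ℤ e (suc m) (suc i) (suc s) *ℚ Fj +ℚ G m i *ℚ term m i s j
      ≡⟨ cong₂ (λ b z → sgn (suc s) *ℚ b *ℚ X *ℚ z *ℚ Fj +ℚ G m i *ℚ term m i s j)
               (trans (cong (λ c → qbinom q c (+ suc s)) (a-suc i)) (qbinom-pascal₁ (a i) s)) q^e-suc ⟩
    sgn (suc s) *ℚ (P *ℚ B₁ +ℚ B₀) *ℚ X *ℚ (E *ℚ G m i) *ℚ Fj +ℚ G m i *ℚ (sgn s *ℚ B₀ *ℚ X *ℚ E *ℚ Fj)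
      ≡⟨ solve 8 (λ σ p b₁ b₀ x e g f → (con (- 1ℚ) :* σ) :* (p :* b₁ :+ b₀) :* x :* (e :* g) :* f :+ g :* (σ :* b₀ :* x :* e :* f)
                                    := (con (- 1ℚ) :* σ) :* b₁ :* x :* (e :* g :* p) :* f)
                 refl (sgn s) P B₁ B₀ X E (G m i) Fj ⟩
    sgn (suc s) *ℚ B₁ *ℚ X *ℚ (E *ℚ G m i *ℚ P) *ℚ Fj
      ≡⟨ cong (λ z → sgn (suc s) *ℚ B₁ *ℚ X *ℚ z *ℚ Fj) (sym q^e-suc-i) ⟩
    term (suc m) i (suc s) j ∎
    where
    X  = x ^ℕ k
    Fj = F (k * j + r)
    P  = q ^ℕ suc s
    B₁ = qbinom q (a i) (+ suc s)
    B₀ = qbinom q (a i) (+ s)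
    E  = q ^ℤ e m i s
    q^e-suc : q ^ℤ e (suc m) (suc i) (suc s) ≡ E *ℚ G m i
    q^e-suc = trans (cong (q ^ℤ_) (e-suc m i s)) (^ℤ-homo-+ (e m i s) (+ (k * m) -ℤ + i))
    q^e-suc-i : q ^ℤ e (suc m) i (suc s) ≡ E *ℚ G m i *ℚ P
    q^e-suc-i = begin
      q ^ℤ e (suc m) i (suc s)                        ≡⟨ cong (q ^ℤ_) (e-suc-i (suc m) i s) ⟩
      q ^ℤ (e (suc m) (suc i) (suc s) +ℤ + suc s)     ≡⟨ ^ℤ-homo-+ℕ (e (suc m) (suc i) (suc s)) (suc s) ⟩
      q ^ℤ e (suc m) (suc i) (suc s) *ℚ P             ≡⟨ cong (_*ℚ P) q^e-suc ⟩
      E *ℚ G m i *ℚ P                                  ∎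

  lhs rhs : ℕ → ℕ → ℚ
  lhs n i = sumTo (n ∸ 1) (summand n i)
  rhs n i = x ^ℕ (r + i) *ℚ F (k * n ∸ i)

  lhs-rec : ∀ m′ i → lhs (2 + m′) (suc i) +ℚ G (suc m′) i *ℚ lhs (suc m′) i ≡ lhs (2 + m′) i
  lhs-rec m′ i = begin
    sumTo m′ (summand n (suc i)) +ℚ summand n (suc i) m +ℚ G m i *ℚ sumTo m′ (summand m i)
      ≡⟨ solve 4 (λ a b g c → a :+ b :+ g :* c
                            := a :+ g :* c :+ b)
               refl (sumTo m′ (summand n (suc i))) (summand n (suc i) m) (G m i) (sumTo m′ (summand m i)) ⟩
    sumTo m′ (summand n (suc i)) +ℚ G m i *ℚ sumTo m′ (summand m i) +ℚ summand n (suc i) m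
      ≡⟨ cong (_+ℚ summand n (suc i) m) (sym (trans (sumTo-+ m′ (summand n (suc i)) (λ j → G m i *ℚ summand m i j))
                                                    (cong (sumTo m′ (summand n (suc i)) +ℚ_) (sumTo-*ˡ m′ (G m i) (summand m i))))) ⟩
    sumTo m′ (λ j → summand n (suc i) j +ℚ G m i *ℚ summand m i j) +ℚ summand n (suc i) m
      ≡⟨ cong₂ _+ℚ_ (sumTo-cong m′ summand-rec) (trans (summand≡term n (suc i) m 0 n∸m≡1) (sym (summand≡term n i m 0 n∸m≡1))) ⟩
    sumTo m′ (summand n i) +ℚ summand n i m ∎
    where
    n = 2 + m′
    m = suc m′
    n∸m≡1 : n ∸ m ≡ 1
    n∸m≡1 = ℕP.m+n∸n≡m 1 m′
    summand-rec : ∀ j → j ≤ m′ → summand n (suc i) j +ℚ G m i *ℚ summand m i j ≡ summand n i j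
    summand-rec j j≤m′ = begin
      summand n (suc i) j +ℚ G m i *ℚ summand m i j
        ≡⟨ cong₂ (λ u v → u +ℚ G m i *ℚ v) (summand≡term n (suc i) j (suc t) n∸j≡2+t) (summand≡term m i j t m∸j≡1+t) ⟩
      term n (suc i) (suc t) j +ℚ G m i *ℚ term m i t j
        ≡⟨ term-rec m i t j ⟩
      term n i (suc t) j
        ≡⟨ sym (summand≡term n i j (suc t) n∸j≡2+t) ⟩
      summand n i j ∎
      where
      t = m′ ∸ j
      m∸j≡1+t : m ∸ j ≡ suc t
      m∸j≡1+t = ℕP.+-∸-assoc 1 j≤m′
      n∸j≡2+t : n ∸ j ≡ suc (suc t)
      n∸j≡2+t = trans (ℕP.+-∸-assoc 1 (ℕP.m≤n⇒m≤1+n j≤m′)) (cong suc m∸j≡1+t)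

  rhs-rec : ∀ m i → i ≤ k * m → rhs (suc m) i ≡ rhs (suc m) (suc i) +ℚ G m i *ℚ rhs m i
  rhs-rec m i i≤km = begin
    x ^ℕ (r + i) *ℚ F (k * suc m ∸ i)
      ≡⟨ cong (λ N → x ^ℕ (r + i) *ℚ F N) k[1+m]∸i≡k+M ⟩
    x ^ℕ (r + i) *ℚ F (k + M)
      ≡⟨ cong (x ^ℕ (r + i) *ℚ_) (qFib-rec M) ⟩
    x ^ℕ (r + i) *ℚ (x *ℚ F (k + M ∸ 1) +ℚ q ^ℕ M *ℚ F M)
      ≡⟨ solve 5 (λ p x f₁ g f₂ → p :* (x :* f₁ :+ g :* f₂)
                                := x :* p :* f₁ :+ g :* (p :* f₂))
               refl (x ^ℕ (r + i)) x (F (k + M ∸ 1)) (q ^ℕ M) (F M) ⟩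
    x *ℚ x ^ℕ (r + i) *ℚ F (k + M ∸ 1) +ℚ q ^ℕ M *ℚ rhs m i
      ≡⟨ cong₃ (cong (x ^ℕ_) (sym (ℕP.+-suc r i))) (cong (_∸ 1) (sym k[1+m]∸i≡k+M)) (sym (^ℤ[m-n]≡^ℕ[m∸n] q i≤km)) ⟩
    x ^ℕ (r + suc i) *ℚ F (k * suc m ∸ i ∸ 1) +ℚ G m i *ℚ rhs m i
      ≡⟨ cong (λ N → x ^ℕ (r + suc i) *ℚ F N +ℚ G m i *ℚ rhs m i) (ℕP.∸-+-assoc (k * suc m) i 1) ⟩
    x ^ℕ (r + suc i) *ℚ F (k * suc m ∸ (i + 1)) +ℚ G m i *ℚ rhs m i
      ≡⟨ cong (λ t → x ^ℕ (r + suc i) *ℚ F (k * suc m ∸ t) +ℚ G m i *ℚ rhs m i) (ℕP.+-comm i 1) ⟩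
    rhs (suc m) (suc i) +ℚ G m i *ℚ rhs m i ∎
    where
    M = k * m ∸ i
    k[1+m]∸i≡k+M : k * suc m ∸ i ≡ k + M
    k[1+m]∸i≡k+M = trans (cong (_∸ i) (ℕP.*-suc k m)) (ℕP.+-∸-assoc k i≤km)
    cong₃ : ∀ {p p′ N N′ g g′} → p ≡ p′ → N ≡ N′ → g ≡ g′ → p *ℚ F N +ℚ g *ℚ rhs m i ≡ p′ *ℚ F N′ +ℚ g′ *ℚ rhs m i
    cong₃ refl refl refl = refl

  term-0 : ∀ n i j → term n i 0 j ≡ x ^ℕ k *ℚ F (k * j + r)
  term-0 n i j = begin
    1ℚ *ℚ 1ℚ *ℚ x ^ℕ k *ℚ q ^ℤ e n i 0 *ℚ F (k * j + r)
      ≡⟨ cong (λ z → 1ℚ *ℚ 1ℚ *ℚ x ^ℕ k *ℚ q ^ℤ z *ℚ F (k * j + r)) e-0 ⟩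
    1ℚ *ℚ 1ℚ *ℚ x ^ℕ k *ℚ 1ℚ *ℚ F (k * j + r)
      ≡⟨ solve 2 (λ p f → con 1ℚ :* con 1ℚ :* p :* con 1ℚ :* f := p :* f) refl (x ^ℕ k) (F (k * j + r)) ⟩
    x ^ℕ k *ℚ F (k * j + r) ∎
    where
    e-0 : e n i 0 ≡ + 0
    e-0 = trans (ℤP.+-identityʳ (+ 0 -ℤ + (k * 0))) (+a-+b≡+c (sym (trans (ℕP.+-identityʳ (k * 0)) (ℕP.*-zeroʳ k))))

  identity-one : ∀ i → 0 < i → i ≤ k → lhs 1 i ≡ rhs 1 i
  identity-one i 0<i i≤k = begin
    summand 1 i 0                      ≡⟨ summand≡term 1 i 0 0 refl ⟩
    term 1 i 0 0                       ≡⟨ term-0 1 i 0 ⟩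
    x ^ℕ k *ℚ F (k * 0 + r)            ≡⟨ cong (λ z → x ^ℕ k *ℚ F (z + r)) (ℕP.*-zeroʳ k) ⟩
    x ^ℕ k *ℚ F r                      ≡⟨ cong (x ^ℕ k *ℚ_) (qFib-below r<k) ⟩
    x ^ℕ k *ℚ x ^ℕ r                   ≡⟨ sym (^ℕ-homo-+ x k r) ⟩
    x ^ℕ (k + r)                       ≡⟨ cong (x ^ℕ_) k+r≡r+i+[k∸i] ⟩
    x ^ℕ (r + i + (k ∸ i))             ≡⟨ ^ℕ-homo-+ x (r + i) (k ∸ i) ⟩
    x ^ℕ (r + i) *ℚ x ^ℕ (k ∸ i)       ≡⟨ cong (x ^ℕ (r + i) *ℚ_) (sym (qFib-below (ℕP.∸-monoʳ-< {o = 0} 0<i i≤k))) ⟩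
    x ^ℕ (r + i) *ℚ F (k ∸ i)          ≡⟨ cong (λ z → x ^ℕ (r + i) *ℚ F (z ∸ i)) (sym (ℕP.*-identityʳ k)) ⟩
    rhs 1 i                            ∎
    where
    k+r≡r+i+[k∸i] : k + r ≡ r + i + (k ∸ i)
    k+r≡r+i+[k∸i] = trans (ℕP.+-comm k r) (trans (cong (λ t → r + t) (sym (ℕP.m+[n∸m]≡n i≤k))) (sym (ℕP.+-assoc r i (k ∸ i))))

  identity-at-k∸r : ∀ m → lhs (suc m) (k ∸ r) ≡ rhs (suc m) (k ∸ r)
  identity-at-k∸r m = begin
    sumTo m (summand n i₀)             ≡⟨ sumTo-last m (summand n i₀) summand-vanish ⟩
    summand n i₀ m                     ≡⟨ summand≡term n i₀ m 0 (ℕP.m+n∸n≡m 1 m) ⟩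
    term n i₀ 0 m                      ≡⟨ term-0 n i₀ m ⟩
    x ^ℕ k *ℚ F (k * m + r)            ≡⟨ cong₂ (λ u v → x ^ℕ u *ℚ F v) (sym (ℕP.m+[n∸m]≡n (ℕP.<⇒≤ r<k))) (sym kn∸i₀≡km+r) ⟩
    rhs n i₀                           ∎
    where
    n = suc m
    i₀ = k ∸ r
    kn∸i₀≡km+r : k * n ∸ i₀ ≡ k * m + r
    kn∸i₀≡km+r = begin
      k * n ∸ i₀        ≡⟨ cong (_∸ i₀) (trans (ℕP.*-suc k m) (ℕP.+-comm k (k * m))) ⟩
      k * m + k ∸ i₀    ≡⟨ ℕP.+-∸-assoc (k * m) (ℕP.m∸n≤m k r) ⟩
      k * m + (k ∸ i₀)  ≡⟨ cong (λ t → k * m + t) (ℕP.m∸[m∸n]≡n (ℕP.<⇒≤ r<k)) ⟩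
      k * m + r         ∎
    a[k∸r]≡0 : a i₀ ≡ + 0
    a[k∸r]≡0 = trans (cong (λ t → (t -ℤ + k) +ℤ + r) (sym (trans (ℤP.m-n≡m⊖n k r) (ℤP.⊖-≥ (ℕP.<⇒≤ r<k)))))
                     (polynomial (+ k) (+ r))
      where
      polynomial : ∀ K R → ((K -ℤ R) -ℤ K) +ℤ R ≡ + 0
      polynomial = ℤRing.solve-∀
    summand-vanish : ∀ j → j < m → summand n i₀ j ≡ 0ℚ
    summand-vanish j j<m = begin
      summand n i₀ j
        ≡⟨ summand≡term n i₀ j (suc t) (trans (ℕP.+-∸-assoc 1 (ℕP.<⇒≤ j<m)) (cong suc (ℕP.+-∸-assoc 1 j<m))) ⟩
      sgn (suc t) *ℚ qbinom q (a i₀) (+ suc t) *ℚ x ^ℕ k *ℚ q ^ℤ e n i₀ (suc t) *ℚ F (k * j + r)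
        ≡⟨ cong (λ b → sgn (suc t) *ℚ b *ℚ x ^ℕ k *ℚ q ^ℤ e n i₀ (suc t) *ℚ F (k * j + r)) [0,1+t]≡0 ⟩
      sgn (suc t) *ℚ 0ℚ *ℚ x ^ℕ k *ℚ q ^ℤ e n i₀ (suc t) *ℚ F (k * j + r)
        ≡⟨ solve 4 (λ s p e f → s :* con 0ℚ :* p :* e :* f := con 0ℚ) refl (sgn (suc t)) (x ^ℕ k) (q ^ℤ e n i₀ (suc t)) (F (k * j + r)) ⟩
      0ℚ ∎
      where
      t = m ∸ suc j
      [0,1+t]≡0 : qbinom q (a i₀) (+ suc t) ≡ 0ℚ
      [0,1+t]≡0 = trans (cong (λ c → qbinom q c (+ suc t)) a[k∸r]≡0)
                        (trans (cong (λ u → qbinom q (+ 0) (+ suc u)) (sym (ℕP.+-identityʳ t))) (qbinom-vanish q 0 t))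

  identity : ∀ m i → 0 < i → i < k + suc m → lhs (suc m) i ≡ rhs (suc m) i
  identity zero     i 0<i i<k+1 = identity-one i 0<i (ℕP.≤-pred (subst (i <_) (ℕP.+-comm k 1) i<k+1))
  identity (suc m′) i 0<i i<k+n = x∙y⁻¹≈ε⇒x≈y (lhs n i) (rhs n i) (begin
    difference i   ≡⟨ ≡-on-interval difference difference-suc 0<i (ℕP.≤-pred (subst (i <_) (ℕP.+-suc k m) i<k+n)) ⟩
    difference 1   ≡⟨ sym (≡-on-interval difference difference-suc (ℕP.m<n⇒0<n∸m r<k) (ℕP.≤-trans (ℕP.m∸n≤m k r) (ℕP.m≤m+n k m))) ⟩
    difference i₀  ≡⟨ cong (_-ℚ rhs n i₀) (identity-at-k∸r m) ⟩
    rhs n i₀ -ℚ rhs n i₀ ≡⟨ ℚP.+-inverseʳ (rhs n i₀) ⟩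
    0ℚ             ∎)
    where
    m = suc m′
    n = suc m
    i₀ = k ∸ r
    difference : ℕ → ℚ
    difference i = lhs n i -ℚ rhs n i
    difference-suc : ∀ i → 1 ≤ i → suc i ≤ k + m → difference (suc i) ≡ difference i
    difference-suc i 0<i i<k+m = a′-b′≡a-b (lhs n (suc i)) (rhs n (suc i)) (G m i *ℚ lhs m i) (lhs-rec m′ i)
      (sym (trans (rhs-rec m i (i<k+m⇒i≤k*m k≥1 (s≤s z≤n) i<k+m))
                  (cong (λ v → rhs n (suc i) +ℚ G m i *ℚ v) (sym (identity m′ i 0<i i<k+m)))))

lemma11 : (k r n : ℕ) → 1 ≤ k → r < k → 1 ≤ n →
    (x q : ℚ) → q ≢ 0ℚ → q ≢ 1ℚ → q ≢ - 1ℚ →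
    (sumTo n (λ j →
        sgn j *ℚ qbinom q (+ (r + 1)) (+ j)
          *ℚ (q ^ℤ ((+ (n * k * j) +ℤ + (j C 2)) -ℤ + (k * ((j + 1) C 2))))
          *ℚ qFib k x q (k * (n ∸ j) + r))
      ≡ (x ^ℕ (r + 1)) *ℚ qFib k x q (k * n ∸ 1))
    ×
    ((i : ℕ) → 0 < i → i < k + n →
      sumTo (n ∸ 1) (λ j →
        sgn (n ∸ 1 ∸ j) *ℚ qbinom q ((+ i -ℤ + k) +ℤ + r) (+ (n ∸ 1 ∸ j))
          *ℚ (x ^ℕ k)
          *ℚ (q ^ℤ (((+ ((n ∸ j ∸ 1) C 2)) -ℤ + (k * ((n ∸ j) C 2)))
                     +ℤ (+ (n ∸ j ∸ 1) *ℤ ((+ (k * n) -ℤ + i) +ℤ + 1))))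
          *ℚ qFib k x q (k * j + r))
      ≡ (x ^ℕ (r + i)) *ℚ qFib k x q (k * n ∸ i))
lemma11 k r (suc n′) k≥1 r<k _ x q q≢0 q≢1 q≢-1 =
  FirstIdentity.identity k≥1 x q q≢0 q≢1 q≢-1 n′ r r<k ,
  SecondIdentity.identity k≥1 r<k x q q≢0 q≢1 q≢-1 n′
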